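{- Let $\tau$ be obtained from $\tau_0$ by adding pairs and let $\varphi_{0\tau}$ be a $\tau$-extension of $\varphi_0$. Assume $\mathbf A\models\varphi_{0\tau}$ and that $\mathbf B$ is a finite $<$-substructure of $\mathbf A$ with $\mathbf B\models\varphi_{1\tau}$. Then $\mathbf B=\mathbf A$ (in particular $\mathbf A\models\varphi_{1\tau}$).
   Context: $\tau_0=\{<,U_{\min},U_{\max},S\}$ with $<,S$ binary and $U_{\min},U_{\max}$ unary. $\varphi_0$ is the conjunction of: $\forall x\neg x<x$; $\forall x\forall y(x<y\vee x=y\vee y<x)$; $\forall x\forall y\forall z((x<y\wedge y<z)\to x<z)$; $\forall x\forall y(U_{\min}x\to(x=y\vee x<y))$; $\forall x\forall y(U_{\max}x\to(x=y\vee y<x))$; $\forall x\forall y(Sxy\to x<y)$; $\forall x\forall y\forall z((x<y\wedge y<z)\to\neg Sxz)$. $\varphi_1:=\exists x\,U_{\min}x\wedge\exists x\,U_{\max}x\wedge\forall x\forall y(x<y\to\exists z\,Sxz)$. A vocabulary $\tau$ is obtained from $\tau_0$ by adding pairs if $\tau=\tau_0\cup\{R,R^{c}\mid R\text{ standard}\}$ for finitely many new "standard" unary or binary symbols $R$, each with a new "complement" symbol $R^c$ of the same arity. A relation symbol is negative in a formula if all its atomic occurrences are in the scope of an odd number of negations (implications $\alpha\to\beta$ read as $\neg\alpha\vee\beta$). A $\tau$-extension of $\varphi_0$ is a universal $\tau$-sentence $\varphi_{0\tau}$ having $\varphi_0$ and $\bigwedge_{R\text{ standard}}\forall\bar x(\neg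 R\bar x\vee\neg R^c\bar x)$ as conjuncts, in which every relation symbol other than $<$ is negative. $\varphi_{1\tau}:=\varphi_1\wedge\bigwedge_{R\text{ standard}}\forall\bar x(R\bar x\vee R^c\bar x)$. For $\tau$-structures, $\mathbf B$ is a $<$-substructure of $\mathbf A$ if $B\subseteq A$, $T^{\mathbf B}\subseteq T^{\mathbf A}$ for all $T\in\tau$, and $<^{\mathbf B}=<^{\mathbf A}\cap(B\times B)$. -}

module Defs where

open import Data.Nat using (ℕ; zero; suc)
open import Data.Fin using (Fin; zero; suc)
open import Data.Vec using (Vec; []; _∷_; map; reverse; allFin)
open import Data.List using (List; []; _∷_)
import Data.List as List
open import Data.List.Membership.Propositional using (_∈_)
open import Data.Bool using (Bool; true; false; not)
open import Data.Product using (Σ; _×_; _,_; ∃)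
open import Data.Sum using (_⊎_)
open import Data.Unit using (⊤)
open import Relation.Nullary using (¬_)
open import Relation.Binary.PropositionalEquality using (_≡_)
open import Function.Bundles using (_↔_)

data Ar : Set where
  unary binary : Ar

⟦_⟧ar : Ar → ℕ
⟦ unary ⟧ar = 1
⟦ binary ⟧ar = 2

record Vocabulary : Set where
  field
    k  : ℕ
    ar : Fin k → Ar
open Vocabulary public

-- The symbols of τ = τ₀ ∪ {R_i, R_i^c | i < k}
data Sym (V : Vocabulary) : Set where
  lt umin umax succ : Sym V
  std cstd : Fin (k V) → Sym V

arity : {V : Vocabulary} → Sym V → ℕ
arity lt = 2
arity umin = 1
arity umax = 1
arity succ = 2
arity {V} (std i) = ⟦ ar V i ⟧ar
arity {V} (cstd i) = ⟦ ar V i ⟧ar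

infixr 6 _∧ᶠ_
infixr 5 _∨ᶠ_
infixr 4 _⇒ᶠ_

data Formula (V : Vocabulary) : ℕ → Set where
  rel  : ∀ {n} (s : Sym V) → Vec (Fin n) (arity s) → Formula V n
  _≐_  : ∀ {n} → Fin n → Fin n → Formula V n
  ⊤ᶠ   : ∀ {n} → Formula V n
  ¬ᶠ_  : ∀ {n} → Formula V n → Formula V n
  _∧ᶠ_ _∨ᶠ_ _⇒ᶠ_ : ∀ {n} → Formula V n → Formula V n → Formula V n
  ∀ᶠ_ ∃ᶠ_ : ∀ {n} → Formula V (suc n) → Formula V n

data QF {V : Vocabulary} : ∀ {n} → Formula V n → Set where
  qf-rel : ∀ {n} s (xs : Vec (Fin n) (arity s)) → QF (rel s xs)
  qf-eq  : ∀ {n} (x y : Fin n) → QF (x ≐ y)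
  qf-⊤   : ∀ {n} → QF {n = n} ⊤ᶠ
  qf-¬   : ∀ {n} {φ : Formula V n} → QF φ → QF (¬ᶠ φ)
  qf-∧   : ∀ {n} {φ ψ : Formula V n} → QF φ → QF ψ → QF (φ ∧ᶠ ψ)
  qf-∨   : ∀ {n} {φ ψ : Formula V n} → QF φ → QF ψ → QF (φ ∨ᶠ ψ)
  qf-⇒   : ∀ {n} {φ ψ : Formula V n} → QF φ → QF ψ → QF (φ ⇒ᶠ ψ)

data Universal {V : Vocabulary} : ∀ {n} → Formula V n → Set where
  u-qf : ∀ {n} {φ : Formula V n} → QF φ → Universal φ
  u-∧  : ∀ {n} {φ ψ : Formula V n} → Universal φ → Universal ψ → Universal (φ ∧ᶠ ψ)
  u-∨  : ∀ {n} {φ ψ : Formula V n} → Universal φ → Universal ψ → Universal (φ ∨ᶠ ψ)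
  u-∀  : ∀ {n} {φ : Formula V (suc n)} → Universal φ → Universal (∀ᶠ φ)

data Conjunct {V : Vocabulary} {n : ℕ} (φ : Formula V n) : Formula V n → Set where
  here  : Conjunct φ φ
  left  : ∀ {ψ χ} → Conjunct φ ψ → Conjunct φ (ψ ∧ᶠ χ)
  right : ∀ {ψ χ} → Conjunct φ χ → Conjunct φ (ψ ∧ᶠ χ)

-- Polarity.  NegAt b s φ : every atomic occurrence of s in φ lies in the
-- scope of a number m of negations (inside φ) with (b xor m) odd.
-- (α ⇒ β is read as ¬α ∨ β.)
NegAt : {V : Vocabulary} {n : ℕ} → Bool → Sym V → Formula V n → Set
NegAt b s (rel s′ xs) = s′ ≡ s → b ≡ true
NegAt b s (x ≐ y) = ⊤
NegAt b s ⊤ᶠ = ⊤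
NegAt b s (¬ᶠ φ) = NegAt (not b) s φ
NegAt b s (φ ∧ᶠ ψ) = NegAt b s φ × NegAt b s ψ
NegAt b s (φ ∨ᶠ ψ) = NegAt b s φ × NegAt b s ψ
NegAt b s (φ ⇒ᶠ ψ) = NegAt (not b) s φ × NegAt b s ψ
NegAt b s (∀ᶠ φ) = NegAt b s φ
NegAt b s (∃ᶠ φ) = NegAt b s φ

Negative : {V : Vocabulary} {n : ℕ} → Sym V → Formula V n → Set
Negative s φ = NegAt false s φ

record Structure (V : Vocabulary) : Set₁ where
  field
    Carrier : Set
    Rel     : (s : Sym V) → Vec Carrier (arity s) → Set
open Structure public

_∷ᵉ_ : {A : Set} {n : ℕ} → A → (Fin n → A) → Fin (suc n) → A
(a ∷ᵉ ρ) zero = a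
(a ∷ᵉ ρ) (suc i) = ρ i

Sat : {V : Vocabulary} {n : ℕ} (M : Structure V) → Formula V n → (Fin n → Carrier M) → Set
Sat M (rel s xs) ρ = Rel M s (map ρ xs)
Sat M (x ≐ y) ρ = ρ x ≡ ρ y
Sat M ⊤ᶠ ρ = ⊤
Sat M (¬ᶠ φ) ρ = ¬ Sat M φ ρ
Sat M (φ ∧ᶠ ψ) ρ = Sat M φ ρ × Sat M ψ ρ
Sat M (φ ∨ᶠ ψ) ρ = Sat M φ ρ ⊎ Sat M ψ ρ
Sat M (φ ⇒ᶠ ψ) ρ = Sat M φ ρ → Sat M ψ ρ
Sat M (∀ᶠ φ) ρ = (a : Carrier M) → Sat M φ (a ∷ᵉ ρ)
Sat M (∃ᶠ φ) ρ = Σ (Carrier M) λ a → Sat M φ (a ∷ᵉ ρ)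

emptyEnv : {A : Set} → Fin 0 → A
emptyEnv ()

infix 3 _⊨_
_⊨_ : {V : Vocabulary} → Structure V → Formula V 0 → Set
M ⊨ φ = Sat M φ emptyEnv

v0 : ∀ {n} → Fin (suc n)
v0 = zero
v1 : ∀ {n} → Fin (suc (suc n))
v1 = suc zero
v2 : ∀ {n} → Fin (suc (suc (suc n)))
v2 = suc (suc zero)

module _ {V : Vocabulary} where

  _<ᶠ_ : ∀ {n} → Fin n → Fin n → Formula V n
  x <ᶠ y = rel lt (x ∷ y ∷ [])

  Sᶠ : ∀ {n} → Fin n → Fin n → Formula V n
  Sᶠ x y = rel succ (x ∷ y ∷ [])

  Uminᶠ Umaxᶠ : ∀ {n} → Fin n → Formula V n
  Uminᶠ x = rel umin (x ∷ [])
  Umaxᶠ x = rel umax (x ∷ [])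

  -- the seven conjuncts of φ₀ (x,y,z bound outermost-first)
  φ₀-axioms : List (Formula V 0)
  φ₀-axioms =
      (∀ᶠ ¬ᶠ (v0 <ᶠ v0))
    ∷ (∀ᶠ ∀ᶠ ((v1 <ᶠ v0) ∨ᶠ (v1 ≐ v0) ∨ᶠ (v0 <ᶠ v1)))
    ∷ (∀ᶠ ∀ᶠ ∀ᶠ (((v2 <ᶠ v1) ∧ᶠ (v1 <ᶠ v0)) ⇒ᶠ (v2 <ᶠ v0)))
    ∷ (∀ᶠ ∀ᶠ (Uminᶠ v1 ⇒ᶠ ((v1 ≐ v0) ∨ᶠ (v1 <ᶠ v0))))
    ∷ (∀ᶠ ∀ᶠ (Umaxᶠ v1 ⇒ᶠ ((v1 ≐ v0) ∨ᶠ (v0 <ᶠ v1))))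
    ∷ (∀ᶠ ∀ᶠ (Sᶠ v1 v0 ⇒ᶠ (v1 <ᶠ v0)))
    ∷ (∀ᶠ ∀ᶠ ∀ᶠ (((v2 <ᶠ v1) ∧ᶠ (v1 <ᶠ v0)) ⇒ᶠ ¬ᶠ Sᶠ v2 v0))
    ∷ []

  φ₁ : Formula V 0
  φ₁ = (∃ᶠ Uminᶠ v0) ∧ᶠ (∃ᶠ Umaxᶠ v0)
       ∧ᶠ (∀ᶠ ∀ᶠ ((v1 <ᶠ v0) ⇒ᶠ ∃ᶠ Sᶠ v2 v0))

  ∀^ : (m : ℕ) → Formula V m → Formula V 0
  ∀^ zero φ = φ
  ∀^ (suc m) φ = ∀^ m (∀ᶠ φ)

  vars : (m : ℕ) → Vec (Fin m) m
  vars m = reverse (allFin m)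

  disjoint-axiom : Fin (k V) → Formula V 0
  disjoint-axiom i = ∀^ ⟦ ar V i ⟧ar
    ((¬ᶠ rel (std i) (vars _)) ∨ᶠ (¬ᶠ rel (cstd i) (vars _)))

  total-axiom : Fin (k V) → Formula V 0
  total-axiom i = ∀^ ⟦ ar V i ⟧ar
    (rel (std i) (vars _) ∨ᶠ rel (cstd i) (vars _))

  ⋀ : ∀ {n} → List (Formula V n) → Formula V n
  ⋀ [] = ⊤ᶠ
  ⋀ (φ ∷ φs) = φ ∧ᶠ ⋀ φs

  φ₁τ : Formula V 0
  φ₁τ = φ₁ ∧ᶠ ⋀ (List.map total-axiom (List.allFin (k V)))

  record IsExtension (φ : Formula V 0) : Set where
    field
      universal   : Universal φ
      has-φ₀      : ∀ ψ → ψ ∈ φ₀-axioms → Conjunct ψ φ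
      has-disjoint : ∀ i → Conjunct (disjoint-axiom i) φ
      negative    : ∀ (s : Sym V) → ¬ (s ≡ lt) → Negative s φ

module _ {V : Vocabulary} where

  record LtSubstructure (B A : Structure V) : Set where
    field
      ι          : Carrier B → Carrier A
      ι-injective : ∀ {x y} → ι x ≡ ι y → x ≡ y
      rel-⊆      : ∀ (s : Sym V) (xs : Vec (Carrier B) (arity s)) →
                     Rel B s xs → Rel A s (map ι xs)
      lt-reflect : ∀ (xs : Vec (Carrier B) 2) →
                     Rel A lt (map ι xs) → Rel B lt xs
  open LtSubstructure public

  -- B = A : the embedding is onto and all relations coincide
  IsWhole : {B A : Structure V} → LtSubstructure B A → Set
  IsWhole {B} {A} e =
    (∀ (a : Carrier A) → ∃ λ b → ι e b ≡ a) ×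
    (∀ (s : Sym V) (xs : Vec (Carrier B) (arity s)) →
       Rel A s (map (ι e) xs) → Rel B s xs)

Finite : Set → Set
Finite X = Σ ℕ λ n → X ↔ Fin n

-- The substructure B is a finite successor order from its minimum to its
-- maximum, and its successor steps stay immediate in A.  Climbing from the
-- minimum of B towards any a ∈ A along B-successors can only stop at a, and it
-- must stop because B is finite; so B exhausts A.  A tuple of B that lies in a
-- relation of A lies in the same relation of B: for <, Uₘᵢₙ, Uₘₐₓ and S
-- because these are determined by the order, and for R, Rᶜ because B decides
-- every tuple between R and Rᶜ while A keeps them disjoint.
module Submission where

open import Defs
open import Data.Empty using (⊥; ⊥-elim)
open import Data.Fin using (Fin; zero; suc; _<_)
open import Data.Fin.Properties using (pigeonhole)
open import Data.List using (List; []; _∷_)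
import Data.List as List
open import Data.List.Membership.Propositional using (_∈_)
open import Data.List.Membership.Propositional.Properties using (∈-map⁺; ∈-allFin)
open import Data.List.Relation.Unary.Any using (here; there)
open import Data.Nat using (ℕ; z<s; s<s)
open import Data.Nat.Properties using (n<1+n)
open import Data.Product using (_×_; _,_; ∃; proj₁)
open import Data.Sum using (_⊎_; inj₁; inj₂; [_,_])
open import Data.Unit using (tt)
open import Data.Vec using (Vec; []; _∷_; map; reverse; allFin; lookup)
open import Data.Vec.Properties using (map-cong; map-reverse; map-lookup-allFin; reverse-involutive)
open import Function.Base using (_∘_)
open import Function.Bundles using (Injection)
open import Function.Properties.Inverse using (↔⇒↣)
open import Relation.Binary.PropositionalEquality using (_≡_; refl; sym; cong; subst; module ≡-Reasoning)
open import Relation.Nullary using (¬_)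

module _ {V : Vocabulary} where

  Sat-conjunct : ∀ {n} {φ ψ : Formula V n} (M : Structure V) {ρ} →
                 Conjunct φ ψ → Sat M ψ ρ → Sat M φ ρ
  Sat-conjunct M here     sat       = sat
  Sat-conjunct M (left c)  (sat , _) = Sat-conjunct M c sat
  Sat-conjunct M (right c) (_ , sat) = Sat-conjunct M c sat

  ⊨⋀⁻ : ∀ (M : Structure V) {φs ψ} → ψ ∈ φs → M ⊨ ⋀ φs → M ⊨ ψ
  ⊨⋀⁻ M (here refl) (sat , _) = sat
  ⊨⋀⁻ M (there ψ∈φs) (_ , sat) = ⊨⋀⁻ M ψ∈φs sat

  ⊨⋀-map⁺ : ∀ (M : Structure V) (f : Fin (k V) → Formula V 0) (is : List (Fin (k V))) →
            (∀ i → M ⊨ f i) → M ⊨ ⋀ (List.map f is)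
  ⊨⋀-map⁺ M f []       sat = tt
  ⊨⋀-map⁺ M f (i ∷ is) sat = sat i , ⊨⋀-map⁺ M f is sat

  ⊨φ₁τ⁻ : ∀ (M : Structure V) → M ⊨ φ₁τ → ∀ i → M ⊨ total-axiom i
  ⊨φ₁τ⁻ M (_ , sat) i = ⊨⋀⁻ M (∈-map⁺ total-axiom (∈-allFin i)) sat

env : {C : Set} {m : ℕ} → Vec C m → Fin m → C
env []       = emptyEnv
env (y ∷ ys) = y ∷ᵉ env ys

env-lookup : {C : Set} {m : ℕ} (ys : Vec C m) (i : Fin m) → env ys i ≡ lookup ys i
env-lookup (y ∷ ys) zero    = refl
env-lookup (y ∷ ys) (suc i) = env-lookup ys i

-- env lists the values innermost binder first, vars lists the variables
-- outermost binder first; hence the reversals.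
module _ {V : Vocabulary} (M : Structure V) where

  map-env-vars : {m : ℕ} (xs : Vec (Carrier M) m) → map (env (reverse xs)) (vars {V} m) ≡ xs
  map-env-vars {m} xs = begin
    map (env (reverse xs)) (reverse (allFin m))     ≡⟨ map-cong (env-lookup (reverse xs)) _ ⟩
    map (lookup (reverse xs)) (reverse (allFin m))  ≡⟨ map-reverse (lookup (reverse xs)) (allFin m) ⟩
    reverse (map (lookup (reverse xs)) (allFin m))  ≡⟨ cong reverse (map-lookup-allFin (reverse xs)) ⟩
    reverse (reverse xs)                            ≡⟨ reverse-involutive xs ⟩
    xs                                              ∎
    where open ≡-Reasoning

  ⊨∀^⁻ : (m : ℕ) {φ : Formula V m} → M ⊨ ∀^ m φ → (ys : Vec (Carrier M) m) → Sat M φ (env ys)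
  ⊨∀^⁻ ℕ.zero    sat []       = sat
  ⊨∀^⁻ (ℕ.suc m) sat (y ∷ ys) = ⊨∀^⁻ m sat ys y

  ⊨∀^⁺ : (m : ℕ) {φ : Formula V m} → (∀ ρ → Sat M φ ρ) → M ⊨ ∀^ m φ
  ⊨∀^⁺ ℕ.zero    sat = sat emptyEnv
  ⊨∀^⁺ (ℕ.suc m) sat = ⊨∀^⁺ m (λ ρ a → sat (a ∷ᵉ ρ))

  ⊨total-axiom⁻ : ∀ i → M ⊨ total-axiom i →
                  ∀ xs → Rel M (std i) xs ⊎ Rel M (cstd i) xs
  ⊨total-axiom⁻ i sat xs =
    subst (λ ys → Rel M (std i) ys ⊎ Rel M (cstd i) ys) (map-env-vars xs)
          (⊨∀^⁻ ⟦ ar V i ⟧ar sat (reverse xs))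

  ⊨total-axiom⁺ : ∀ i → (∀ xs → Rel M (std i) xs ⊎ Rel M (cstd i) xs) → M ⊨ total-axiom i
  ⊨total-axiom⁺ i total = ⊨∀^⁺ ⟦ ar V i ⟧ar (λ ρ → total (map ρ (vars {V} _)))

  ⊨disjoint-axiom⁻ : ∀ i → M ⊨ disjoint-axiom i →
                     ∀ xs → Rel M (std i) xs → Rel M (cstd i) xs → ⊥
  ⊨disjoint-axiom⁻ i sat xs r rᶜ =
    [ (λ ¬r → ¬r r) , (λ ¬rᶜ → ¬rᶜ rᶜ) ]
      (subst (λ ys → ¬ Rel M (std i) ys ⊎ ¬ Rel M (cstd i) ys) (map-env-vars xs)
             (⊨∀^⁻ ⟦ ar V i ⟧ar sat (reverse xs)))

module _ {X W : Set} (_≺_ : X → X → Set)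
         (≺-trans : ∀ {x y z} → x ≺ y → y ≺ z → x ≺ z) (≺-irrefl : ∀ {x} → ¬ x ≺ x) where

  Ascending : ∀ {n} → (Fin n → X) → Set
  Ascending c = ∀ {i j} → i < j → c i ≺ c j

  finite⇒¬Ascending : ((n , _) : Finite X) (c : Fin (ℕ.suc n) → X) → ¬ Ascending c
  finite⇒¬Ascending (n , X↔Fin) c ascending
    = let i , j , i<j , same = pigeonhole (n<1+n n) (to ∘ c)
      in ≺-irrefl (subst (c i ≺_) (sym (injective same)) (ascending i<j))
    where open Injection (↔⇒↣ X↔Fin)

  -- A climb that cannot stop without reaching W would produce an ascending
  -- chain longer than X.
  module _ (P : X → Set) (climb : ∀ x → P x → W ⊎ ∃ λ z → x ≺ z × P z) where

    climb-or-Ascending : ∀ n x → P x → W ⊎ ∃ λ (c : Fin (ℕ.suc n) → X) → c zero ≡ x × Ascending c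
    climb-or-Ascending ℕ.zero x _ = inj₂ ((λ _ → x) , refl , λ { {zero} {zero} () })
    climb-or-Ascending (ℕ.suc n) x px with climb x px
    ... | inj₁ w = inj₁ w
    ... | inj₂ (z , x≺z , pz) with climb-or-Ascending n z pz
    ...   | inj₁ w = inj₁ w
    ...   | inj₂ (c , refl , ascending) = inj₂ ((x ∷ᵉ c) , refl , ascending′)
      where
      ascending′ : Ascending (x ∷ᵉ c)
      ascending′ {zero}  {zero}        ()
      ascending′ {zero}  {suc zero}    _         = x≺z
      ascending′ {zero}  {suc (suc j)} _         = ≺-trans x≺z (ascending {zero} {suc j} z<s)
      ascending′ {suc i} {suc j}       (s<s i<j) = ascending i<j

    climb-terminates : Finite X → ∀ x → P x → W
    climb-terminates finite x px with climb-or-Ascending (proj₁ finite) x px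
    ... | inj₁ w = w
    ... | inj₂ (c , _ , ascending) = ⊥-elim (finite⇒¬Ascending finite c ascending)

module φ₀-Properties {V : Vocabulary} (A : Structure V)
                     (A⊨φ₀ : ∀ {ψ} → ψ ∈ φ₀-axioms → A ⊨ ψ) where

  _≺_ : Carrier A → Carrier A → Set
  x ≺ y = Rel A lt (x ∷ y ∷ [])

  Succ : Carrier A → Carrier A → Set
  Succ x y = Rel A succ (x ∷ y ∷ [])

  IsMin IsMax : Carrier A → Set
  IsMin x = Rel A umin (x ∷ [])
  IsMax x = Rel A umax (x ∷ [])

  ≺-irrefl : ∀ {x} → ¬ x ≺ x
  ≺-irrefl {x} = A⊨φ₀ (here refl) x

  ≺-trichotomy : ∀ x y → x ≺ y ⊎ x ≡ y ⊎ y ≺ x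
  ≺-trichotomy = A⊨φ₀ (there (here refl))

  ≺-trans : ∀ {x y z} → x ≺ y → y ≺ z → x ≺ z
  ≺-trans {x} {y} {z} x≺y y≺z = A⊨φ₀ (there (there (here refl))) x y z (x≺y , y≺z)

  IsMin-least : ∀ {x} → IsMin x → ∀ y → x ≡ y ⊎ x ≺ y
  IsMin-least {x} min y = A⊨φ₀ (there (there (there (here refl)))) x y min

  IsMax-greatest : ∀ {x} → IsMax x → ∀ y → x ≡ y ⊎ y ≺ x
  IsMax-greatest {x} max y = A⊨φ₀ (there (there (there (there (here refl))))) x y max

  Succ⇒≺ : ∀ {x y} → Succ x y → x ≺ y
  Succ⇒≺ {x} {y} = A⊨φ₀ (there (there (there (there (there (here refl)))))) x y

  Succ-immediate : ∀ {x y z} → x ≺ y → y ≺ z → ¬ Succ x z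
  Succ-immediate {x} {y} {z} x≺y y≺z =
    A⊨φ₀ (there (there (there (there (there (there (here refl))))))) x y z (x≺y , y≺z)

  ≺-asym : ∀ {x y} → x ≺ y → ¬ y ≺ x
  ≺-asym x≺y y≺x = ≺-irrefl (≺-trans x≺y y≺x)

  IsMin-unique : ∀ {x y} → IsMin x → IsMin y → x ≡ y
  IsMin-unique {x} {y} min-x min-y with IsMin-least min-x y | IsMin-least min-y x
  ... | inj₁ x≡y | _        = x≡y
  ... | inj₂ _   | inj₁ y≡x = sym y≡x
  ... | inj₂ x≺y | inj₂ y≺x = ⊥-elim (≺-asym x≺y y≺x)

  IsMax-unique : ∀ {x y} → IsMax x → IsMax y → x ≡ y
  IsMax-unique {x} {y} max-x max-y with IsMax-greatest max-x y | IsMax-greatest max-y x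
  ... | inj₁ x≡y | _        = x≡y
  ... | inj₂ _   | inj₁ y≡x = sym y≡x
  ... | inj₂ y≺x | inj₂ x≺y = ⊥-elim (≺-asym x≺y y≺x)

  Succ-least : ∀ {x y a} → Succ x y → x ≺ a → y ≡ a ⊎ y ≺ a
  Succ-least {x} {y} {a} s x≺a with ≺-trichotomy y a
  ... | inj₁ y≺a        = inj₂ y≺a
  ... | inj₂ (inj₁ y≡a) = inj₁ y≡a
  ... | inj₂ (inj₂ a≺y) = ⊥-elim (Succ-immediate x≺a a≺y s)

  Succ-functional : ∀ {x y z} → Succ x y → Succ x z → y ≡ z
  Succ-functional s-xy s-xz with Succ-least s-xy (Succ⇒≺ s-xz)
  ... | inj₁ y≡z = y≡z
  ... | inj₂ y≺z = ⊥-elim (Succ-immediate (Succ⇒≺ s-xy) y≺z s-xz)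

module _ {V : Vocabulary} {B A : Structure V} (e : LtSubstructure B A)
         (ι-onto : ∀ a → ∃ λ b → ι e b ≡ a) where

  map-ι-onto : ∀ {n} (as : Vec (Carrier A) n) → ∃ λ bs → map (ι e) bs ≡ as
  map-ι-onto []       = [] , refl
  map-ι-onto (a ∷ as) with ι-onto a | map-ι-onto as
  ... | b , refl | bs , refl = b ∷ bs , refl

  ⊨φ₁-onto : B ⊨ φ₁ → A ⊨ φ₁
  ⊨φ₁-onto ((m , min) , (M , max) , B-succ) =
    (ι e m , rel-⊆ e umin _ min) , (ι e M , rel-⊆ e umax _ max) , A-succ
    where
    A-succ : ∀ x y → Rel A lt (x ∷ y ∷ []) → ∃ λ z → Rel A succ (x ∷ z ∷ [])
    A-succ x y x<y with ι-onto x | ι-onto y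
    ... | bx , refl | by , refl =
      let z , s = B-succ bx by (lt-reflect e (bx ∷ by ∷ []) x<y)
      in ι e z , rel-⊆ e succ (bx ∷ z ∷ []) s

  ⊨total-axiom-onto : ∀ i → B ⊨ total-axiom i → A ⊨ total-axiom i
  ⊨total-axiom-onto i B⊨total = ⊨total-axiom⁺ A i total
    where
    total : ∀ as → Rel A (std i) as ⊎ Rel A (cstd i) as
    total as with map-ι-onto as
    ... | bs , refl with ⊨total-axiom⁻ B i B⊨total bs
    ...   | inj₁ r  = inj₁ (rel-⊆ e (std i) bs r)
    ...   | inj₂ rᶜ = inj₂ (rel-⊆ e (cstd i) bs rᶜ)

  ⊨φ₁τ-onto : B ⊨ φ₁τ → A ⊨ φ₁τ
  ⊨φ₁τ-onto B⊨φ₁τ@(B⊨φ₁ , _) =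
    ⊨φ₁-onto B⊨φ₁ ,
    ⊨⋀-map⁺ A total-axiom (List.allFin (k V)) (λ i → ⊨total-axiom-onto i (⊨φ₁τ⁻ B B⊨φ₁τ i))

module _ {V : Vocabulary} {B A : Structure V}
         (A⊨φ₀ : ∀ {ψ} → ψ ∈ φ₀-axioms → A ⊨ ψ) (e : LtSubstructure B A) where

  open φ₀-Properties A A⊨φ₀

  ι-onto : Finite (Carrier B) → B ⊨ φ₁ → ∀ a → ∃ λ b → ι e b ≡ a
  ι-onto finite ((m , min) , (M , max) , B-succ) a with IsMin-least (rel-⊆ e umin _ min) a
  ... | inj₁ ιm≡a = m , ιm≡a
  ... | inj₂ ιm≺a =
    climb-terminates (λ b c → ι e b ≺ ι e c) ≺-trans ≺-irrefl
                     (λ b → ι e b ≺ a) climb finite m ιm≺a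
    where
    climb : ∀ b → ι e b ≺ a → (∃ λ b → ι e b ≡ a) ⊎ ∃ λ c → ι e b ≺ ι e c × ι e c ≺ a
    climb b ιb≺a with IsMax-greatest (rel-⊆ e umax _ max) a
    ... | inj₁ ιM≡a = inj₁ (M , ιM≡a)
    ... | inj₂ a≺ιM with B-succ b M (lt-reflect e (b ∷ M ∷ []) (≺-trans ιb≺a a≺ιM))
    ...   | c , s with Succ-least (rel-⊆ e succ _ s) ιb≺a
    ...     | inj₁ ιc≡a = inj₁ (c , ιc≡a)
    ...     | inj₂ ιc≺a = inj₂ (c , Succ⇒≺ (rel-⊆ e succ _ s) , ιc≺a)

  ι-reflects : B ⊨ φ₁τ → (∀ i → A ⊨ disjoint-axiom i) →
               ∀ s xs → Rel A s (map (ι e) xs) → Rel B s xs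
  ι-reflects _ _ lt xs r = lt-reflect e xs r
  ι-reflects (((m , min) , _) , _) _ umin (x ∷ []) r =
    subst (λ y → Rel B umin (y ∷ [])) (ι-injective e (IsMin-unique (rel-⊆ e umin _ min) r)) min
  ι-reflects ((_ , (M , max) , _) , _) _ umax (x ∷ []) r =
    subst (λ y → Rel B umax (y ∷ [])) (ι-injective e (IsMax-unique (rel-⊆ e umax _ max) r)) max
  ι-reflects ((_ , _ , B-succ) , _) _ succ (x ∷ y ∷ []) r =
    let z , s = B-succ x y (lt-reflect e (x ∷ y ∷ []) (Succ⇒≺ r))
    in subst (λ w → Rel B succ (x ∷ w ∷ [])) (ι-injective e (Succ-functional (rel-⊆ e succ _ s) r)) s
  ι-reflects B⊨φ₁τ A⊨disjoint (std i) xs r with ⊨total-axiom⁻ B i (⊨φ₁τ⁻ B B⊨φ₁τ i) xs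
  ... | inj₁ r′ = r′
  ... | inj₂ rᶜ = ⊥-elim (⊨disjoint-axiom⁻ A i (A⊨disjoint i) _ r (rel-⊆ e (cstd i) xs rᶜ))
  ι-reflects B⊨φ₁τ A⊨disjoint (cstd i) xs rᶜ with ⊨total-axiom⁻ B i (⊨φ₁τ⁻ B B⊨φ₁τ i) xs
  ... | inj₁ r   = ⊥-elim (⊨disjoint-axiom⁻ A i (A⊨disjoint i) _ (rel-⊆ e (std i) xs r) rᶜ)
  ... | inj₂ rᶜ′ = rᶜ′

lemma3p8 : (V : Vocabulary) (φ₀τ : Formula V 0) → IsExtension φ₀τ →
           (A B : Structure V) → A ⊨ φ₀τ →
           (e : LtSubstructure B A) → Finite (Carrier B) → B ⊨ φ₁τ →
           IsWhole e × (A ⊨ φ₁τ)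
lemma3p8 V φ₀τ extension A B A⊨φ₀τ e finite B⊨φ₁τ@(B⊨φ₁ , _) =
  (onto , ι-reflects A⊨φ₀ e B⊨φ₁τ A⊨disjoint) , ⊨φ₁τ-onto e onto B⊨φ₁τ
  where
  open IsExtension extension
  A⊨φ₀ : ∀ {ψ} → ψ ∈ φ₀-axioms → A ⊨ ψ
  A⊨φ₀ ψ∈φ₀ = Sat-conjunct A (has-φ₀ _ ψ∈φ₀) A⊨φ₀τ
  A⊨disjoint : ∀ i → A ⊨ disjoint-axiom i
  A⊨disjoint i = Sat-conjunct A (has-disjoint i) A⊨φ₀τ
  onto : ∀ a → ∃ λ b → ι e b ≡ a
  onto = ι-onto A⊨φ₀ e finite B⊨φ₁
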